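{- Let $G$ be a finite simple graph of order $n$. Then $\alpha_1'(G) \ge 0$, with equality if and only if $G \cong tK_2 \cup (n-2t)K_1$ for some integer $t \ge 0$.
   Context: All graphs are finite, simple and undirected. For a graph $G$, a $1$-nearly edge independent set of $G$ is a set $M \subseteq E(G)$ such that $M$ contains exactly one (unordered) pair of distinct edges that are adjacent in $G$ (i.e. share a common end vertex). The $1$-nearly edge independence number $\alpha_1'(G)$ is the maximum cardinality of a $1$-nearly edge independent set of $G$, taken to be $0$ if $G$ has no such set. $K_m$ denotes the complete graph on $m$ vertices, $tH$ denotes the disjoint union of $t$ copies of a graph $H$, and $\cup$ denotes disjoint union of graphs. -}

module Defs where

open import Data.Bool using (Bool; true; false; _∧_; not)
open import Data.Nat using (ℕ; _≤_; _<_; _*_; _<ᵇ_; _≡ᵇ_; _/_)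
open import Data.Fin using (Fin; toℕ)
open import Data.List using (List; length; filter; allFin; cartesianProduct)
open import Data.Product using (_×_; _,_; proj₁; proj₂; ∃; ∃-syntax; Σ-syntax)
open import Data.Sum using (_⊎_)
open import Relation.Binary.PropositionalEquality using (_≡_; _≢_)
open import Relation.Nullary using (¬_)
open import Relation.Nullary.Decidable using (does)
open import Data.Bool.Properties using (T?)
open import Function.Bundles using (_↔_; Inverse)

record Graph (n : ℕ) : Set where
  field
    Adj   : Fin n → Fin n → Bool
    sym   : ∀ i j → Adj i j ≡ Adj j i
    irref : ∀ i → Adj i i ≡ false
open Graph public

-- An edge {i,j} is represented canonically by the ordered pair (i , j) with i < j.
Pair : ℕ → Set
Pair n = Fin n × Fin n

Canon : ∀ {n} → Pair n → Set
Canon (i , j) = toℕ i < toℕ j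

-- A set of edges M ⊆ E(G): given by a symmetric Boolean indicator contained in Adj.
EdgeSet : ℕ → Set
EdgeSet n = Fin n → Fin n → Bool

IsEdgeSubset : ∀ {n} → Graph n → EdgeSet n → Set
IsEdgeSubset G M =
  (∀ i j → M i j ≡ M j i) × (∀ i j → M i j ≡ true → Adj G i j ≡ true)

InM : ∀ {n} → EdgeSet n → Pair n → Set
InM M e = Canon e × (M (proj₁ e) (proj₂ e) ≡ true)

ShareEnd : ∀ {n} → Pair n → Pair n → Set
ShareEnd (a , b) (c , d) = (a ≡ c) ⊎ (a ≡ d) ⊎ (b ≡ c) ⊎ (b ≡ d)

AdjPair : ∀ {n} → EdgeSet n → Pair n → Pair n → Set
AdjPair M e f = e ≢ f × InM M e × InM M f × ShareEnd e f

ExactlyOneAdjPair : ∀ {n} → EdgeSet n → Set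
ExactlyOneAdjPair M =
  Σ[ e ∈ _ ] Σ[ f ∈ _ ] (AdjPair M e f ×
    (∀ e' f' → AdjPair M e' f' → (e' ≡ e × f' ≡ f) ⊎ (e' ≡ f × f' ≡ e)))

IsNearlyEdgeIndep : ∀ {n} → Graph n → EdgeSet n → Set
IsNearlyEdgeIndep G M = IsEdgeSubset G M × ExactlyOneAdjPair M

allPairs : (n : ℕ) → List (Pair n)
allPairs n = cartesianProduct (allFin n) (allFin n)

card : ∀ {n} → EdgeSet n → ℕ
card {n} M = length (filter (λ p → T? ((toℕ (proj₁ p) <ᵇ toℕ (proj₂ p)) ∧ M (proj₁ p) (proj₂ p))) (allPairs n))

IsAlpha1 : ∀ {n} → Graph n → ℕ → Set
IsAlpha1 G k =
  (Σ[ M ∈ _ ] (IsNearlyEdgeIndep G M × card M ≡ k ×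
      (∀ M' → IsNearlyEdgeIndep G M' → card M' ≤ k)))
  ⊎ ((∀ M → ¬ IsNearlyEdgeIndep G M) × k ≡ 0)

-- adjacency of t K₂ ∪ (n - 2t) K₁ on Fin n: vertices 2s and 2s+1 (s < t) are joined.
matchAdj : (n t : ℕ) → Fin n → Fin n → Bool
matchAdj n t i j =
  (toℕ i <ᵇ 2 * t) ∧ (toℕ j <ᵇ 2 * t) ∧ not (toℕ i ≡ᵇ toℕ j) ∧ ((toℕ i / 2) ≡ᵇ (toℕ j / 2))

IsoTo : ∀ {n} → Graph n → (Fin n → Fin n → Bool) → Set
IsoTo {n} G H = Σ[ φ ∈ Fin n ↔ Fin n ] (∀ i j → Adj G i j ≡ H (Inverse.to φ i) (Inverse.to φ j))

{-# OPTIONS --safe #-}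
-- A 1-nearly edge independent set contains an edge, so α₁'(G) = 0 exactly when G has no
-- such set. Two edges ab, ac at a vertex a form one, and conversely the adjacent pair of
-- such a set puts two neighbours at a vertex; so α₁'(G) = 0 exactly when every vertex has
-- degree at most 1. Such a graph is matched with tK₂ ∪ (n - 2t)K₁ vertex by vertex: an
-- isolated vertex 0 goes after all pairs, and 0 together with its neighbour becomes the
-- pair {0, 1} in front of the rest.
module Submission where

open import Defs
open import Data.Nat using (ℕ; _≤_; _*_)
open import Data.Product using (_×_; Σ-syntax)
open import Relation.Binary.PropositionalEquality using (_≡_)
open import Function.Bundles using (_⇔_)

open import Data.Bool using (Bool; true; false)
open import Data.Bool.Properties using (¬-not; T-≡; T-∧) renaming (_≟_ to _≟ᵇ_)
open import Data.Empty using (⊥-elim)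
open import Data.Fin using (Fin; zero; suc; toℕ; fromℕ; punchIn)
open import Data.Fin.Permutation using (Permutation; _⟨$⟩ʳ_; _⟨$⟩ˡ_; inverseʳ; id; flip; _∘ₚ_; insert; lift₀; transpose)
import Data.Fin.Properties as Finₚ
open import Data.List.Membership.Propositional.Properties using (∈-filter⁺; ∈-cartesianProduct⁺; ∈-allFin; ∈-length)
open import Data.Nat using (zero; suc; _+_; _∸_; _<_; _/_; _%_; z≤n; s≤s; z<s; s<s; s<s⁻¹)
open import Data.Nat.DivMod using (m≡m%n+[m/n]*n; m%n<n; m/n≡1+[m∸n]/n; m<n⇒m/n≡0)
import Data.Nat.Properties as ℕₚ
open import Data.Product using (_,_; proj₁; proj₂)
open import Data.Sum using (_⊎_; inj₁; inj₂)
import Data.Sum as Sum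
open import Function.Base using (_∘_; _∘′_; const)
open import Function.Bundles using (Equivalence; Injection; mk⇔)
open import Function.Construct.Composition using (_⇔-∘_)
open import Function.Definitions using (Injective)
open import Function.Properties.Inverse using (↔⇒↣)
open import Relation.Binary.Definitions using (tri<; tri≈; tri>)
open import Relation.Binary.PropositionalEquality as ≡ using (_≢_; refl; cong; cong₂; trans; subst; module ≡-Reasoning)
open import Relation.Nullary using (¬_; Dec; yes; no; does; contradiction)
open import Relation.Nullary.Decidable using (_×-dec_; _⊎-dec_; ¬?; dec-true; dec-false; does-⇔)

dec-true⁻¹ : ∀ {P : Set} (p? : Dec P) → does p? ≡ true → P
dec-true⁻¹ (yes p) _ = p

-- matchAdj n t i j is definitionally does (paired? (2 * t) (toℕ i) (toℕ j)).
Paired : ℕ → ℕ → ℕ → Set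
Paired c x y = x < c × y < c × x ≢ y × x / 2 ≡ y / 2

paired? : ∀ c x y → Dec (Paired c x y)
paired? c x y = x ℕₚ.<? c ×-dec y ℕₚ.<? c ×-dec ¬? (x ℕₚ.≟ y) ×-dec x / 2 ℕₚ.≟ y / 2

Paired-sym : ∀ {c x y} → Paired c x y → Paired c y x
Paired-sym (x<c , y<c , x≢y , x≈y) = y<c , x<c , x≢y ∘ ≡.sym , ≡.sym x≈y

Paired-irrefl : ∀ {c x} → ¬ Paired c x x
Paired-irrefl (_ , _ , x≢x , _) = x≢x refl

[2+m]/2≡1+m/2 : ∀ m → (2 + m) / 2 ≡ 1 + m / 2
[2+m]/2≡1+m/2 m = m/n≡1+[m∸n]/n {2 + m} (s≤s (s≤s z≤n))

¬Paired-<2-2+ : ∀ {c x y} → x < 2 → ¬ Paired c x (2 + y)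
¬Paired-<2-2+ {y = y} x<2 (_ , _ , _ , x≈2+y) =
  contradiction (trans (≡.sym (m<n⇒m/n≡0 x<2)) (trans x≈2+y ([2+m]/2≡1+m/2 y))) λ ()

Paired-shift : ∀ t x y → Paired (2 * t) x y ⇔ Paired (2 * suc t) (2 + x) (2 + y)
Paired-shift t x y rewrite ℕₚ.*-suc 2 t = mk⇔
  (λ (x<c , y<c , x≢y , x≈y) →
     s<s (s<s x<c) , s<s (s<s y<c) , x≢y ∘ ℕₚ.suc-injective ∘ ℕₚ.suc-injective ,
     trans ([2+m]/2≡1+m/2 x) (trans (cong suc x≈y) (≡.sym ([2+m]/2≡1+m/2 y))))
  (λ (x<c , y<c , x≢y , x≈y) →
     s<s⁻¹ (s<s⁻¹ x<c) , s<s⁻¹ (s<s⁻¹ y<c) , x≢y ∘ cong (2 +_) ,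
     ℕₚ.suc-injective (trans (≡.sym ([2+m]/2≡1+m/2 x)) (trans x≈y ([2+m]/2≡1+m/2 y))))

/2-%2-injective : ∀ {m n} → m / 2 ≡ n / 2 → m % 2 ≡ n % 2 → m ≡ n
/2-%2-injective {m} {n} m≈n m%≡n% = begin
  m                 ≡⟨ m≡m%n+[m/n]*n m 2 ⟩
  m % 2 + m / 2 * 2 ≡⟨ cong₂ (λ r q → r + q * 2) m%≡n% m≈n ⟩
  n % 2 + n / 2 * 2 ≡⟨ ≡.sym (m≡m%n+[m/n]*n n 2) ⟩
  n                 ∎
  where open ≡-Reasoning

<2-≢⇒≡1∸ : ∀ {a b} → a < 2 → b < 2 → a ≢ b → a ≡ 1 ∸ b
<2-≢⇒≡1∸ {0} {0} _ _ 0≢0 = contradiction refl 0≢0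
<2-≢⇒≡1∸ {0} {1} _ _ _ = refl
<2-≢⇒≡1∸ {1} {0} _ _ _ = refl
<2-≢⇒≡1∸ {1} {1} _ _ 1≢1 = contradiction refl 1≢1
<2-≢⇒≡1∸ {suc (suc _)} (s≤s (s≤s ())) _ _
<2-≢⇒≡1∸ {_} {suc (suc _)} _ (s≤s (s≤s ())) _

-- x and y have the same half as u and the parity opposite to u.
Paired-functional : ∀ {c u x y} → Paired c u x → Paired c u y → x ≡ y
Paired-functional {u = u} {x} {y} (_ , _ , u≢x , u≈x) (_ , _ , u≢y , u≈y) =
  /2-%2-injective (trans (≡.sym u≈x) u≈y) (trans (opposite-parity u≢x u≈x) (≡.sym (opposite-parity u≢y u≈y)))
  where
  opposite-parity : ∀ {v} → u ≢ v → u / 2 ≡ v / 2 → v % 2 ≡ 1 ∸ u % 2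
  opposite-parity {v} u≢v u≈v =
    <2-≢⇒≡1∸ (m%n<n v 2) (m%n<n u 2) (λ v%≡u% → u≢v (/2-%2-injective u≈v (≡.sym v%≡u%)))

MaxDegree≤1 : ∀ {n} → (Fin n → Fin n → Bool) → Set
MaxDegree≤1 A = ∀ a b c → A a b ≡ true → A a c ≡ true → b ≡ c

matchAdj-maxDegree≤1 : ∀ n t → MaxDegree≤1 (matchAdj n t)
matchAdj-maxDegree≤1 n t a b c ab ac = Finₚ.toℕ-injective
  (Paired-functional (dec-true⁻¹ (paired? (2 * t) (toℕ a) (toℕ b)) ab)
                     (dec-true⁻¹ (paired? (2 * t) (toℕ a) (toℕ c)) ac))

edge-sym : ∀ {n} (G : Graph n) {x y} → Adj G x y ≡ true → Adj G y x ≡ true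
edge-sym G {x} {y} xy = trans (sym G y x) xy

edge⇒≢ : ∀ {n} (G : Graph n) {x y} → Adj G x y ≡ true → x ≢ y
edge⇒≢ G {x} xy refl = contradiction (trans (≡.sym xy) (irref G x)) λ ()

induced : ∀ {m n} → Graph m → (Fin n → Fin m) → Graph n
induced G f = record
  { Adj   = λ i j → Adj G (f i) (f j)
  ; sym   = λ i j → sym G (f i) (f j)
  ; irref = λ i → irref G (f i)
  }

induced-maxDegree≤1 : ∀ {m n} (G : Graph m) (f : Fin n → Fin m) → Injective _≡_ _≡_ f →
                      MaxDegree≤1 (Adj G) → MaxDegree≤1 (Adj (induced G f))
induced-maxDegree≤1 G f f-injective deg a b c ab ac = f-injective (deg (f a) (f b) (f c) ab ac)

IsoTo-maxDegree≤1 : ∀ {n} (G : Graph n) {H : Fin n → Fin n → Bool} →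
                    IsoTo G H → MaxDegree≤1 H → MaxDegree≤1 (Adj G)
IsoTo-maxDegree≤1 G (φ , iso) H-deg a b c ab ac =
  Injection.injective (↔⇒↣ φ) (H-deg _ _ _ (trans (≡.sym (iso a b)) ab) (trans (≡.sym (iso a c)) ac))

IsoTo-relabel : ∀ {n} (G : Graph n) {H : Fin n → Fin n → Bool} (π : Permutation n n) →
                IsoTo (induced G (π ⟨$⟩ʳ_)) H → IsoTo G H
IsoTo-relabel G {H} π (ψ , ψ-iso) = flip π ∘ₚ ψ , λ i j → begin
  Adj G i j                                     ≡⟨ cong₂ (Adj G) (≡.sym (inverseʳ π)) (≡.sym (inverseʳ π)) ⟩
  Adj G (π ⟨$⟩ʳ (π ⟨$⟩ˡ i)) (π ⟨$⟩ʳ (π ⟨$⟩ˡ j)) ≡⟨ ψ-iso (π ⟨$⟩ˡ i) (π ⟨$⟩ˡ j) ⟩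
  H (ψ ⟨$⟩ʳ (π ⟨$⟩ˡ i)) (ψ ⟨$⟩ʳ (π ⟨$⟩ˡ j))     ∎
  where open ≡-Reasoning

IsoToMatching : ∀ {n} → Graph n → Set
IsoToMatching {n} G = Σ[ t ∈ ℕ ] (2 * t ≤ n × IsoTo G (matchAdj n t))

IsoToMatching-relabel : ∀ {n} (G : Graph n) (π : Permutation n n) →
                        IsoToMatching (induced G (π ⟨$⟩ʳ_)) → IsoToMatching G
IsoToMatching-relabel {n} G π (t , 2t≤n , iso) = t , 2t≤n , IsoTo-relabel G {H = matchAdj n t} π iso

toℕ-punchIn-fromℕ : ∀ {n} (i : Fin n) → toℕ (punchIn (fromℕ n) i) ≡ toℕ i
toℕ-punchIn-fromℕ zero    = refl
toℕ-punchIn-fromℕ (suc i) = cong suc (toℕ-punchIn-fromℕ i)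

-- The isolated vertex 0 is sent to the last vertex n, which lies outside [0, 2t).
isolated-vertex-step : ∀ {n} (G : Graph (suc n)) → (∀ j → Adj G zero j ≡ false) →
                       IsoToMatching (induced G suc) → IsoToMatching G
isolated-vertex-step {n} G 0-isolated (t , 2t≤n , ψ , ψ-iso) = t , ℕₚ.m≤n⇒m≤1+n 2t≤n , φ , φ-iso
  where
  φ : Permutation (suc n) (suc n)
  φ = insert zero (fromℕ n) ψ

  last-unpaired : ∀ {y} → ¬ Paired (2 * t) (toℕ (fromℕ n)) y
  last-unpaired (n<2t , _) = ℕₚ.<⇒≱ n<2t (subst (2 * t ≤_) (≡.sym (Finₚ.toℕ-fromℕ n)) 2t≤n)

  φ-iso : ∀ i j → Adj G i j ≡ matchAdj (suc n) t (φ ⟨$⟩ʳ i) (φ ⟨$⟩ʳ j)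
  φ-iso zero    j       = trans (0-isolated j) (≡.sym (dec-false (paired? _ _ _) last-unpaired))
  φ-iso (suc i) zero    = trans (sym G (suc i) zero) (trans (0-isolated (suc i))
                            (≡.sym (dec-false (paired? _ _ _) (last-unpaired ∘ Paired-sym))))
  φ-iso (suc i) (suc j) = trans (ψ-iso i j) (cong₂ (λ x y → does (paired? (2 * t) x y))
                            (≡.sym (toℕ-punchIn-fromℕ (ψ ⟨$⟩ʳ i))) (≡.sym (toℕ-punchIn-fromℕ (ψ ⟨$⟩ʳ j))))

matched-pair-step : ∀ {n} (G : Graph (2 + n)) → MaxDegree≤1 (Adj G) → Adj G zero (suc zero) ≡ true →
                    IsoToMatching (induced G (suc ∘′ suc)) → IsoToMatching G
matched-pair-step {n} G deg 0~1 (t , 2t≤n , ψ , ψ-iso) = suc t , 2[1+t]≤2+n , φ , φ-iso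
  where
  2[1+t]≤2+n : 2 * suc t ≤ 2 + n
  2[1+t]≤2+n = subst (_≤ 2 + n) (≡.sym (ℕₚ.*-suc 2 t)) (s≤s (s≤s 2t≤n))

  φ : Permutation (2 + n) (2 + n)
  φ = lift₀ (lift₀ ψ)

  0-paired-1 : Paired (2 * suc t) 0 1
  0-paired-1 rewrite ℕₚ.*-suc 2 t = z<s , s<s z<s , (λ ()) , refl

  0-unmatched : ∀ k → Adj G zero (suc (suc k)) ≡ false
  0-unmatched k = ¬-not (λ 0~k → contradiction (deg _ _ _ 0~1 0~k) λ ())

  1-unmatched : ∀ k → Adj G (suc zero) (suc (suc k)) ≡ false
  1-unmatched k = ¬-not (λ 1~k → contradiction (deg _ _ _ (edge-sym G 0~1) 1~k) λ ())

  Entry : Fin (2 + n) → Fin (2 + n) → Set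
  Entry i j = Adj G i j ≡ matchAdj (2 + n) (suc t) (φ ⟨$⟩ʳ i) (φ ⟨$⟩ʳ j)

  both-true : ∀ {i j} → Adj G i j ≡ true → Paired (2 * suc t) (toℕ (φ ⟨$⟩ʳ i)) (toℕ (φ ⟨$⟩ʳ j)) → Entry i j
  both-true ij p = trans ij (≡.sym (dec-true (paired? _ _ _) p))

  both-false : ∀ {i j} → Adj G i j ≡ false → ¬ Paired (2 * suc t) (toℕ (φ ⟨$⟩ʳ i)) (toℕ (φ ⟨$⟩ʳ j)) → Entry i j
  both-false ij ¬p = trans ij (≡.sym (dec-false (paired? _ _ _) ¬p))

  φ-iso : ∀ i j → Entry i j
  φ-iso zero          zero          = both-false (irref G _) Paired-irrefl
  φ-iso zero          (suc zero)    = both-true 0~1 0-paired-1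
  φ-iso zero          (suc (suc l)) = both-false (0-unmatched l) (¬Paired-<2-2+ z<s)
  φ-iso (suc zero)    zero          = both-true (edge-sym G 0~1) (Paired-sym 0-paired-1)
  φ-iso (suc zero)    (suc zero)    = both-false (irref G _) Paired-irrefl
  φ-iso (suc zero)    (suc (suc l)) = both-false (1-unmatched l) (¬Paired-<2-2+ (s<s z<s))
  φ-iso (suc (suc k)) zero          =
    both-false (trans (sym G _ _) (0-unmatched k)) (¬Paired-<2-2+ z<s ∘ Paired-sym)
  φ-iso (suc (suc k)) (suc zero)    =
    both-false (trans (sym G _ _) (1-unmatched k)) (¬Paired-<2-2+ (s<s z<s) ∘ Paired-sym)
  φ-iso (suc (suc k)) (suc (suc l)) = trans (ψ-iso k l)
    (does-⇔ (Paired-shift t _ _) (paired? _ _ _) (paired? _ _ _))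

maxDegree≤1⇒IsoToMatching : ∀ {n} (G : Graph n) → MaxDegree≤1 (Adj G) → IsoToMatching G
maxDegree≤1⇒IsoToMatching {zero} G _ = 0 , z≤n , id , λ ()
maxDegree≤1⇒IsoToMatching {suc n} G deg with Finₚ.any? (λ j → Adj G zero j ≟ᵇ true)
... | no ¬0~j = isolated-vertex-step G (λ j → ¬-not (¬0~j ∘ (j ,_)))
  (maxDegree≤1⇒IsoToMatching {n} (induced G suc) (induced-maxDegree≤1 G suc Finₚ.suc-injective deg))
... | yes (zero , 0~0) = ⊥-elim (edge⇒≢ G 0~0 refl)
maxDegree≤1⇒IsoToMatching {suc (suc n)} G deg | yes (suc j , 0~j) =
  IsoToMatching-relabel G σ (matched-pair-step G′ deg′ 0~j
    (maxDegree≤1⇒IsoToMatching {n} (induced G′ (suc ∘′ suc))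
      (induced-maxDegree≤1 G′ (suc ∘′ suc) (Finₚ.suc-injective ∘′ Finₚ.suc-injective) deg′)))
  where
  σ : Permutation (2 + n) (2 + n)
  σ = transpose (suc zero) (suc j)
  G′ : Graph (2 + n)
  G′ = induced G (σ ⟨$⟩ʳ_)
  deg′ : MaxDegree≤1 (Adj G′)
  deg′ = induced-maxDegree≤1 G (σ ⟨$⟩ʳ_) (Injection.injective (↔⇒↣ σ)) deg

maxDegree≤1⇔IsoToMatching : ∀ {n} (G : Graph n) → MaxDegree≤1 (Adj G) ⇔ IsoToMatching G
maxDegree≤1⇔IsoToMatching {n} G = mk⇔ (maxDegree≤1⇒IsoToMatching G)
  (λ (t , _ , iso) → IsoTo-maxDegree≤1 G {H = matchAdj n t} iso (matchAdj-maxDegree≤1 n t))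

SameEdge : ∀ {n} → Pair n → Pair n → Set
SameEdge (x , y) (u , v) = (x ≡ u × y ≡ v) ⊎ (x ≡ v × y ≡ u)

SameEdge? : ∀ {n} (e f : Pair n) → Dec (SameEdge e f)
SameEdge? (x , y) (u , v) = (x Finₚ.≟ u ×-dec y Finₚ.≟ v) ⊎-dec (x Finₚ.≟ v ×-dec y Finₚ.≟ u)

SameEdge-swap : ∀ {n} {x y : Fin n} {e} → SameEdge (x , y) e → SameEdge (y , x) e
SameEdge-swap (inj₁ (x≡u , y≡v)) = inj₂ (y≡v , x≡u)
SameEdge-swap (inj₂ (x≡v , y≡u)) = inj₁ (y≡u , x≡v)

SameEdge-edge : ∀ {n} (G : Graph n) {x y u v} → SameEdge (x , y) (u , v) → Adj G u v ≡ true → Adj G x y ≡ true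
SameEdge-edge G (inj₁ (refl , refl)) uv = uv
SameEdge-edge G (inj₂ (refl , refl)) uv = edge-sym G uv

SameEdge-shareEnd : ∀ {n} {e f : Pair n} {a b c} → SameEdge e (a , b) → SameEdge f (a , c) → ShareEnd e f
SameEdge-shareEnd (inj₁ (refl , _)) (inj₁ (refl , _)) = inj₁ refl
SameEdge-shareEnd (inj₁ (refl , _)) (inj₂ (_ , refl)) = inj₂ (inj₁ refl)
SameEdge-shareEnd (inj₂ (_ , refl)) (inj₁ (refl , _)) = inj₂ (inj₂ (inj₁ refl))
SameEdge-shareEnd (inj₂ (_ , refl)) (inj₂ (_ , refl)) = inj₂ (inj₂ (inj₂ refl))

SameEdge-cancelˡ : ∀ {n} {e : Pair n} {a b c} → a ≢ b → SameEdge e (a , b) → SameEdge e (a , c) → b ≡ c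
SameEdge-cancelˡ _   (inj₁ (refl , refl)) (inj₁ (_ , b≡c))    = b≡c
SameEdge-cancelˡ a≢b (inj₁ (refl , refl)) (inj₂ (_ , b≡a))    = contradiction (≡.sym b≡a) a≢b
SameEdge-cancelˡ a≢b (inj₂ (refl , refl)) (inj₁ (b≡a , _))    = contradiction (≡.sym b≡a) a≢b
SameEdge-cancelˡ _   (inj₂ (refl , refl)) (inj₂ (b≡c , _))    = b≡c

canonical : ∀ {n} (x y : Fin n) → x ≢ y → Σ[ e ∈ Pair n ] (Canon e × SameEdge e (x , y))
canonical x y x≢y with Finₚ.<-cmp x y
... | tri< x<y _ _ = (x , y) , x<y , inj₁ (refl , refl)
... | tri≈ _ x≡y _ = contradiction x≡y x≢y
... | tri> _ _ y<x = (y , x) , y<x , inj₂ (refl , refl)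

canonical-unique : ∀ {n} {e f p : Pair n} → Canon e → Canon f → SameEdge e p → SameEdge f p → e ≡ f
canonical-unique _   _   (inj₁ (refl , refl)) (inj₁ (refl , refl)) = refl
canonical-unique _   _   (inj₂ (refl , refl)) (inj₂ (refl , refl)) = refl
canonical-unique x<y u<v (inj₁ (refl , refl)) (inj₂ (refl , refl)) = contradiction u<v (ℕₚ.<-asym x<y)
canonical-unique x<y u<v (inj₂ (refl , refl)) (inj₁ (refl , refl)) = contradiction u<v (ℕₚ.<-asym x<y)

shareEnd⇒SameEdge : ∀ {n} (G : Graph n) → MaxDegree≤1 (Adj G) → ∀ {x y u v} →
                    Adj G x y ≡ true → Adj G u v ≡ true → ShareEnd (x , y) (u , v) → SameEdge (x , y) (u , v)
shareEnd⇒SameEdge G deg xy uv (inj₁ refl)                = inj₁ (refl , deg _ _ _ xy uv)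
shareEnd⇒SameEdge G deg xy uv (inj₂ (inj₁ refl))         = inj₂ (refl , deg _ _ _ xy (edge-sym G uv))
shareEnd⇒SameEdge G deg xy uv (inj₂ (inj₂ (inj₁ refl)))  = inj₂ (deg _ _ _ (edge-sym G xy) uv , refl)
shareEnd⇒SameEdge G deg xy uv (inj₂ (inj₂ (inj₂ refl)))  = inj₁ (deg _ _ _ (edge-sym G xy) (edge-sym G uv) , refl)

nearlyEdgeIndep⇒¬maxDegree≤1 : ∀ {n} (G : Graph n) M → IsNearlyEdgeIndep G M → ¬ MaxDegree≤1 (Adj G)
nearlyEdgeIndep⇒¬maxDegree≤1 G M
  ((_ , M⊆G) , (x , y) , (u , v) , (e≢f , (x<y , xy∈M) , (u<v , uv∈M) , share) , _) deg =
  e≢f (canonical-unique x<y u<v (shareEnd⇒SameEdge G deg (M⊆G x y xy∈M) (M⊆G u v uv∈M) share) (inj₁ (refl , refl)))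

path⇒nearlyEdgeIndep : ∀ {n} (G : Graph n) {a b c} → Adj G a b ≡ true → Adj G a c ≡ true → b ≢ c →
                       Σ[ M ∈ EdgeSet n ] IsNearlyEdgeIndep G M
path⇒nearlyEdgeIndep {n} G {a} {b} {c} ab ac b≢c
  with canonical a b (edge⇒≢ G ab) | canonical a c (edge⇒≢ G ac)
... | e , e-canon , e≐ab | f , f-canon , f≐ac =
  M , (M-sym , M⊆G) , e , f , (e≢f , (e-canon , e∈M) , (f-canon , f∈M) , SameEdge-shareEnd e≐ab f≐ac) , only-e-f
  where
  OnPath : Pair n → Set
  OnPath p = SameEdge p (a , b) ⊎ SameEdge p (a , c)

  onPath? : ∀ p → Dec (OnPath p)
  onPath? p = SameEdge? p (a , b) ⊎-dec SameEdge? p (a , c)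

  M : EdgeSet n
  M x y = does (onPath? (x , y))

  M-sym : ∀ x y → M x y ≡ M y x
  M-sym x y = does-⇔ (mk⇔ OnPath-swap OnPath-swap) (onPath? (x , y)) (onPath? (y , x))
    where
    OnPath-swap : ∀ {u v} → OnPath (u , v) → OnPath (v , u)
    OnPath-swap = Sum.map SameEdge-swap SameEdge-swap

  M⊆G : ∀ x y → M x y ≡ true → Adj G x y ≡ true
  M⊆G x y xy∈M with dec-true⁻¹ (onPath? (x , y)) xy∈M
  ... | inj₁ xy≐ab = SameEdge-edge G xy≐ab ab
  ... | inj₂ xy≐ac = SameEdge-edge G xy≐ac ac

  e∈M : M (proj₁ e) (proj₂ e) ≡ true
  e∈M = dec-true (onPath? e) (inj₁ e≐ab)

  f∈M : M (proj₁ f) (proj₂ f) ≡ true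
  f∈M = dec-true (onPath? f) (inj₂ f≐ac)

  e≢f : e ≢ f
  e≢f refl = b≢c (SameEdge-cancelˡ (edge⇒≢ G ab) e≐ab f≐ac)

  e-or-f : ∀ {p} → InM M p → p ≡ e ⊎ p ≡ f
  e-or-f {p} (p-canon , p∈M) with dec-true⁻¹ (onPath? p) p∈M
  ... | inj₁ p≐ab = inj₁ (canonical-unique p-canon e-canon p≐ab e≐ab)
  ... | inj₂ p≐ac = inj₂ (canonical-unique p-canon f-canon p≐ac f≐ac)

  only-e-f : ∀ e′ f′ → AdjPair M e′ f′ → (e′ ≡ e × f′ ≡ f) ⊎ (e′ ≡ f × f′ ≡ e)
  only-e-f e′ f′ (e′≢f′ , e′∈M , f′∈M , _) with e-or-f e′∈M | e-or-f f′∈M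
  ... | inj₁ refl | inj₁ refl = contradiction refl e′≢f′
  ... | inj₁ e′≡e | inj₂ f′≡f = inj₁ (e′≡e , f′≡f)
  ... | inj₂ e′≡f | inj₁ f′≡e = inj₂ (e′≡f , f′≡e)
  ... | inj₂ refl | inj₂ refl = contradiction refl e′≢f′

noNearlyEdgeIndep⇔maxDegree≤1 : ∀ {n} (G : Graph n) → (∀ M → ¬ IsNearlyEdgeIndep G M) ⇔ MaxDegree≤1 (Adj G)
noNearlyEdgeIndep⇔maxDegree≤1 G = mk⇔ to (λ deg M M-nearly → nearlyEdgeIndep⇒¬maxDegree≤1 G M M-nearly deg)
  where
  to : (∀ M → ¬ IsNearlyEdgeIndep G M) → MaxDegree≤1 (Adj G)
  to none a b c ab ac with b Finₚ.≟ c
  ... | yes b≡c = b≡c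
  ... | no  b≢c = let (M , M-nearly) = path⇒nearlyEdgeIndep G ab ac b≢c in contradiction M-nearly (none M)

nearlyEdgeIndep⇒card>0 : ∀ {n} (G : Graph n) M → IsNearlyEdgeIndep G M → 0 < card M
nearlyEdgeIndep⇒card>0 G M (_ , (x , y) , _ , (_ , (x<y , xy∈M) , _) , _) =
  ∈-length (∈-filter⁺ _ (∈-cartesianProduct⁺ (∈-allFin x) (∈-allFin y))
                        (Equivalence.from T-∧ (ℕₚ.<⇒<ᵇ x<y , Equivalence.from T-≡ xy∈M)))

IsAlpha1-≡0⇔noNearlyEdgeIndep : ∀ {n} (G : Graph n) k → IsAlpha1 G k → (k ≡ 0) ⇔ (∀ M → ¬ IsNearlyEdgeIndep G M)
IsAlpha1-≡0⇔noNearlyEdgeIndep G k (inj₁ (M , M-nearly , |M|≡k , _)) = mk⇔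
  (λ k≡0 → ⊥-elim (ℕₚ.<⇒≢ (nearlyEdgeIndep⇒card>0 G M M-nearly) (≡.sym (trans |M|≡k k≡0))))
  (λ none → contradiction M-nearly (none M))
IsAlpha1-≡0⇔noNearlyEdgeIndep G k (inj₂ (none , k≡0)) = mk⇔ (const none) (const k≡0)

theorem3p1 : (n : ℕ) (G : Graph n) (k : ℕ) → IsAlpha1 G k →
    (0 ≤ k) × ((k ≡ 0) ⇔ (Σ[ t ∈ ℕ ] (2 * t ≤ n × IsoTo G (matchAdj n t))))
theorem3p1 n G k α = z≤n ,
  (maxDegree≤1⇔IsoToMatching G ⇔-∘ noNearlyEdgeIndep⇔maxDegree≤1 G) ⇔-∘ IsAlpha1-≡0⇔noNearlyEdgeIndep G k α
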